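{- Let $\phi$ be a rank $2$ Drinfeld module over $\mathbb{C}_\infty$ given by $\phi_T=T+A\tau+B\tau^2$ ($B\neq0$), let $\jmath=A^{q+1}/B$, and write $\log_\phi(z)=\sum_{n\ge0}\beta_nz^{q^n}$. Then for $n\in\mathbb{N}$: \[v(\beta_n)=\begin{cases}\frac{q^n-1}{q-1}(v(A)+q), & \text{if } v(\jmath)<-q,\\[4pt] \frac{q^n-1}{q^2-1}(v(B)+q^2), & \text{if } v(\jmath)>-q \text{ and } n \text{ even},\\[4pt] \frac{q^n-1}{q^2-1}(v(B)+q^2)+\frac{v(\jmath)+q}{q+1}, & \text{if } v(\jmath)>-q \text{ and } n \text{ odd}.\end{cases}\] If $v(\jmath)=-q$, then \[v(\beta_n)\ge\frac{q^n-1}{q-1}(v(A)+q)=\frac{q^n-1}{q^2-1}(v(B)+q^2)\] for all $n$, with equality holding for infinitely many $n$.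
   Context: $q$ is a prime power, $\mathbb{A}=\mathbb{F}_q[T]$, $v$ is the valuation with $v(T)=-1$ extended to $\mathbb{C}_\infty$ (the completion of an algebraic closure of the $v$-adic completion of $\mathbb{F}_q(T)$), with $v(0)=+\infty$. A rank 2 Drinfeld module is given by $\phi_T=T+A\tau+B\tau^2$ with $A,B\in\mathbb{C}_\infty$, $B\ne0$, where $\tau$ is the $q$-Frobenius. Its exponential $e_\phi(z)=z+\sum_{n\ge1}\alpha_nz^{q^n}$ is the entire function with $e_\phi(Tz)=Te_\phi(z)+Ae_\phi(z)^q+Be_\phi(z)^{q^2}$, and $\log_\phi(z)=\sum\beta_nz^{q^n}$ ($\beta_0=1$) is its composition-inverse power series, characterized by $T\log_\phi(z)=\log_\phi(\phi_T(z))$. The $\jmath$-invariant is $\jmath=\jmath(\phi)=A^{q+1}/B$. -}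

module Defs where

open import Level using (Level; _⊔_) renaming (suc to lsuc)
open import Algebra.Bundles using (CommutativeRing)
open import Data.Nat as ℕ using (ℕ; zero; suc)
open import Data.Nat.Primality using (Prime)
open import Data.Integer as ℤ using (ℤ; +_)
open import Data.Rational as ℚ using (ℚ)
open import Data.Product using (Σ; ∃; _×_; _,_)
open import Relation.Nullary using (¬_)
open import Relation.Binary.PropositionalEquality using (_≡_)

-- Extended rationals ℚ ∪ {+∞}  (value group of v, with v(0) = +∞)

data ℚ∞ : Set where
  fin : ℚ → ℚ∞
  ∞   : ℚ∞

infixl 6 _+∞_
_+∞_ : ℚ∞ → ℚ∞ → ℚ∞
fin x +∞ fin y = fin (x ℚ.+ y)
fin x +∞ ∞     = ∞
∞     +∞ y     = ∞

-- scalar multiple c·x with c ∈ ℚ (convention c·∞ = ∞; only used with c > 0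
-- whenever x can be ∞)
infixl 7 _·∞_
_·∞_ : ℚ → ℚ∞ → ℚ∞
c ·∞ fin x = fin (c ℚ.* x)
c ·∞ ∞     = ∞

infix 4 _≤∞_ _<∞_
data _≤∞_ : ℚ∞ → ℚ∞ → Set where
  fin≤fin : ∀ {x y} → x ℚ.≤ y → fin x ≤∞ fin y
  _≤∞∞    : ∀ x → x ≤∞ ∞

data _<∞_ : ℚ∞ → ℚ∞ → Set where
  fin<fin : ∀ {x y} → x ℚ.< y → fin x <∞ fin y
  fin<∞   : ∀ {x} → fin x <∞ ∞

min∞ : ℚ∞ → ℚ∞ → ℚ∞
min∞ (fin x) (fin y) = fin (x ℚ.⊓ y)
min∞ (fin x) ∞       = fin x
min∞ ∞       y       = y

ℕ→ℚ : ℕ → ℚ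
ℕ→ℚ n = (+ n) ℚ./ 1

-- the fraction a / b as a rational (b is always ≥ 1 where used)
frac : ℕ → ℕ → ℚ
frac a zero    = ℚ.0ℚ
frac a (suc b) = (+ a) ℚ./ suc b

IsPrimePower : ℕ → Set
IsPrimePower q = Σ ℕ λ p → Σ ℕ λ k → Prime p × (q ≡ p ℕ.^ suc k)

-- A field K with a non-archimedean valuation v : K → ℚ ∪ {∞},
-- v(0) = ∞.  (Abstract stand-in for ℂ∞ with its valuation.)

record ValuedField c ℓ : Set (lsuc (c ⊔ ℓ)) where
  field
    cring : CommutativeRing c ℓ
  open CommutativeRing cring public hiding (ring)
  field
    0≉1     : ¬ (0# ≈ 1#)
    inverse : ∀ x → ¬ (x ≈ 0#) → Σ Carrier λ y → x * y ≈ 1#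
    v       : Carrier → ℚ∞
    v-cong  : ∀ {x y} → x ≈ y → v x ≡ v y
    v-∞     : ∀ x → v x ≡ ∞ → x ≈ 0#
    v-0     : v 0# ≡ ∞
    v-*     : ∀ x y → v (x * y) ≡ v x +∞ v y
    v-+     : ∀ x y → min∞ (v x) (v y) ≤∞ v (x + y)

  infixr 8 _^_
  _^_ : Carrier → ℕ → Carrier
  x ^ zero  = 1#
  x ^ suc n = x * (x ^ n)

  ι : ℕ → Carrier
  ι zero    = 0#
  ι (suc n) = 1# + ι n

-- Coefficients of log_φ for φ_T = T + A τ + B τ²:
-- β₀ = 1 and the coefficient of z^{q^n} in T·log_φ(z) = log_φ(φ_T(z)),
-- i.e. T βₙ = βₙ T^{qⁿ} + βₙ₋₁ A^{qⁿ⁻¹} + βₙ₋₂ B^{qⁿ⁻²}  (terms with negative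
-- index omitted).

module _ {c ℓ} (K : ValuedField c ℓ) where
  open ValuedField K

  record IsLogCoeffs (q : ℕ) (T A B : Carrier) (β : ℕ → Carrier) : Set (c ⊔ ℓ) where
    field
      β₀ : β 0 ≈ 1#
      β₁ : T * β 1 ≈ β 1 * T ^ (q ℕ.^ 1) + β 0 * A ^ (q ℕ.^ 0)
      βₙ : ∀ n → T * β (suc (suc n)) ≈
                 β (suc (suc n)) * T ^ (q ℕ.^ suc (suc n))
                 + β (suc n) * A ^ (q ℕ.^ suc n)
                 + β n * B ^ (q ℕ.^ n)

module Submission where

-- Write αₙ = v(βₙ), u = v(A) + q and w = v(B) + q².  Dividing the defining
-- relation T βₙ₊₂ = βₙ₊₂ T^{qⁿ⁺²} + βₙ₊₁ A^{qⁿ⁺¹} + βₙ B^{qⁿ} by T − T^{qⁿ⁺²}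
-- (of valuation −qⁿ⁺²) shows that αₙ₊₂ is an ultrametric sum of the two
-- "Newton candidates" αₙ₊₁ + qⁿ⁺¹u and αₙ + qⁿw: it is at least one of them
-- and equals the strictly smaller one.  Together with α₀ = 0 and α₁ = u this
-- is an abstract recurrence (NewtonRecurrence) on ℚ ∪ {∞}.  Since
-- v(j) + q = (q+1)u − w, the three cases of the lemma are the three possible
-- orderings of (q+1)u and w, and each is settled by induction for the
-- recurrence alone: if (q+1)u < w the left candidate always wins, if
-- (q+1)u > w the right one always wins, and if (q+1)u = w both candidates
-- give the lower bound, with equality at one of any two consecutive indices.

open import Defs
open import Data.Nat as ℕ using (ℕ; zero; suc; _∸_; _≤_)
open import Data.Nat.Primality using (Prime; prime⇒nonZero; prime⇒nonTrivial)
open import Data.Rational as ℚ using (ℚ; 0ℚ; 1ℚ)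
open import Data.Product using (Σ; _×_; _,_; proj₁; proj₂)
open import Data.Sum using (_⊎_; inj₁; inj₂) renaming (map to ⊎-map)
open import Data.Empty using (⊥; ⊥-elim)
open import Relation.Nullary using (¬_; Dec; yes; no)
open import Relation.Binary.PropositionalEquality
  using (_≡_; refl; sym; trans; cong; cong₂; subst; subst₂; module ≡-Reasoning)
open import Relation.Binary.Definitions using (tri<; tri≈; tri>)
open import Data.Integer using (+_)
import Data.Nat.Properties as ℕP
import Data.Rational.Properties as ℚP
import Data.Rational.Unnormalised as U
import Data.Rational.Unnormalised.Properties as UP
import Data.Integer.Solver as ℤSolver
open import Data.Rational.Solver using (module +-*-Solver)
open +-*-Solver
open ℤSolver.+-*-Solver using ()
  renaming (solve to solveℤ; _:+_ to _⊕_; _:*_ to _⊗_; _:=_ to _≐_; con to κ)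

ℕ→ℚᵘ : ∀ m → ℚ.toℚᵘ (ℕ→ℚ m) U.≃ U.mkℚᵘ (+ m) 0
ℕ→ℚᵘ m = ℚP.toℚᵘ-fromℚᵘ (U.mkℚᵘ (+ m) 0)

ℕ→ℚ-suc : ∀ n → ℕ→ℚ (suc n) ≡ 1ℚ ℚ.+ ℕ→ℚ n
ℕ→ℚ-suc n = ℚP.toℚᵘ-injective (UP.≃-trans (ℕ→ℚᵘ (suc n))
  (UP.≃-sym (UP.≃-trans (ℚP.toℚᵘ-homo-+ 1ℚ (ℕ→ℚ n))
    (UP.≃-trans (UP.+-cong (ℕ→ℚᵘ 1) (ℕ→ℚᵘ n)) (UP.≃-sym unnormalised)))))
  where
  unnormalised : U.mkℚᵘ (+ suc n) 0 U.≃ (U.mkℚᵘ (+ 1) 0 U.+ U.mkℚᵘ (+ n) 0)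
  unnormalised = U.*≡* (solveℤ 1 (λ x → (κ (+ 1) ⊕ x) ⊗ κ (+ 1)
                   ≐ (κ (+ 1) ⊗ κ (+ 1) ⊕ x ⊗ κ (+ 1)) ⊗ κ (+ 1)) refl (+ n))

ℕ→ℚ-+ : ∀ m n → ℕ→ℚ (m ℕ.+ n) ≡ ℕ→ℚ m ℚ.+ ℕ→ℚ n
ℕ→ℚ-+ zero n = sym (ℚP.+-identityˡ (ℕ→ℚ n))
ℕ→ℚ-+ (suc m) n = begin
  ℕ→ℚ (suc (m ℕ.+ n))              ≡⟨ ℕ→ℚ-suc (m ℕ.+ n) ⟩
  1ℚ ℚ.+ ℕ→ℚ (m ℕ.+ n)             ≡⟨ cong (1ℚ ℚ.+_) (ℕ→ℚ-+ m n) ⟩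
  1ℚ ℚ.+ (ℕ→ℚ m ℚ.+ ℕ→ℚ n)         ≡⟨ sym (ℚP.+-assoc 1ℚ (ℕ→ℚ m) (ℕ→ℚ n)) ⟩
  (1ℚ ℚ.+ ℕ→ℚ m) ℚ.+ ℕ→ℚ n         ≡⟨ cong (ℚ._+ ℕ→ℚ n) (sym (ℕ→ℚ-suc m)) ⟩
  ℕ→ℚ (suc m) ℚ.+ ℕ→ℚ n            ∎
  where open ≡-Reasoning

ℕ→ℚ-* : ∀ m n → ℕ→ℚ (m ℕ.* n) ≡ ℕ→ℚ m ℚ.* ℕ→ℚ n
ℕ→ℚ-* zero n = sym (ℚP.*-zeroˡ (ℕ→ℚ n))
ℕ→ℚ-* (suc m) n = begin
  ℕ→ℚ (n ℕ.+ m ℕ.* n)              ≡⟨ ℕ→ℚ-+ n (m ℕ.* n) ⟩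
  ℕ→ℚ n ℚ.+ ℕ→ℚ (m ℕ.* n)          ≡⟨ cong (ℕ→ℚ n ℚ.+_) (ℕ→ℚ-* m n) ⟩
  ℕ→ℚ n ℚ.+ ℕ→ℚ m ℚ.* ℕ→ℚ n        ≡⟨ solve 2 (λ x y → x :+ y :* x := (con 1ℚ :+ y) :* x) refl (ℕ→ℚ n) (ℕ→ℚ m) ⟩
  (1ℚ ℚ.+ ℕ→ℚ m) ℚ.* ℕ→ℚ n         ≡⟨ cong (ℚ._* ℕ→ℚ n) (sym (ℕ→ℚ-suc m)) ⟩
  ℕ→ℚ (suc m) ℚ.* ℕ→ℚ n            ∎
  where open ≡-Reasoning

ℕ→ℚ-pred : ∀ {m} → 1 ≤ m → ℕ→ℚ (m ∸ 1) ≡ ℕ→ℚ m ℚ.- 1ℚ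
ℕ→ℚ-pred {suc m} _ = begin
  ℕ→ℚ m                    ≡⟨ solve 1 (λ x → x := (con 1ℚ :+ x) :- con 1ℚ) refl (ℕ→ℚ m) ⟩
  (1ℚ ℚ.+ ℕ→ℚ m) ℚ.- 1ℚ    ≡⟨ cong (ℚ._- 1ℚ) (sym (ℕ→ℚ-suc m)) ⟩
  ℕ→ℚ (suc m) ℚ.- 1ℚ       ∎
  where open ≡-Reasoning

frac-spec : ∀ a {D} → 1 ≤ D → frac a D ℚ.* ℕ→ℚ D ≡ ℕ→ℚ a
frac-spec a {suc d} _ = ℚP.toℚᵘ-injective
  (UP.≃-trans (ℚP.toℚᵘ-homo-* (frac a (suc d)) (ℕ→ℚ (suc d)))
  (UP.≃-trans (UP.*-cong (ℚP.toℚᵘ-fromℚᵘ (U.mkℚᵘ (+ a) d)) (ℕ→ℚᵘ (suc d)))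
  (UP.≃-trans unnormalised (UP.≃-sym (ℕ→ℚᵘ a)))))
  where
  unnormalised : (U.mkℚᵘ (+ a) d U.* U.mkℚᵘ (+ suc d) 0) U.≃ U.mkℚᵘ (+ a) 0
  unnormalised = U.*≡* (solveℤ 2 (λ x y → (x ⊗ (κ (+ 1) ⊕ y)) ⊗ κ (+ 1)
                   ≐ x ⊗ ((κ (+ 1) ⊕ y) ⊗ κ (+ 1))) refl (+ a) (+ d))

ℕ→ℚ-pos : ∀ n → 0ℚ ℚ.< ℕ→ℚ (suc n)
ℕ→ℚ-pos n = ℚP.positive⁻¹ (ℕ→ℚ (suc n)) {{ℚP.normalize-pos (suc n) 1}}

ℕ→ℚ-mono-< : ∀ {m n} → m ℕ.< n → ℕ→ℚ m ℚ.< ℕ→ℚ n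
ℕ→ℚ-mono-< {m} {n} m<n = subst (λ k → ℕ→ℚ m ℚ.< ℕ→ℚ k) k+1+m≡n m<m+k
  where
  k = n ∸ suc m
  k+1+m≡n : suc k ℕ.+ m ≡ n
  k+1+m≡n = trans (sym (ℕP.+-suc k m)) (ℕP.m∸n+n≡m m<n)
  m<m+k : ℕ→ℚ m ℚ.< ℕ→ℚ (suc k ℕ.+ m)
  m<m+k = subst₂ ℚ._<_ (ℚP.+-identityˡ (ℕ→ℚ m)) (sym (ℕ→ℚ-+ (suc k) m))
            (ℚP.+-monoˡ-< (ℕ→ℚ m) (ℕ→ℚ-pos k))

<-by-gap : ∀ {x y} d → 0ℚ ℚ.< d → y ≡ x ℚ.+ d → x ℚ.< y
<-by-gap {x} d 0<d refl = subst (ℚ._< x ℚ.+ d) (ℚP.+-identityʳ x) (ℚP.+-monoʳ-< x 0<d)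

0<-difference : ∀ {x y} → x ℚ.< y → 0ℚ ℚ.< y ℚ.- x
0<-difference {x} {y} x<y = subst (ℚ._< y ℚ.- x) (ℚP.+-inverseʳ x) (ℚP.+-monoˡ-< (ℚ.- x) x<y)

pos*pos : ∀ {x y} → 0ℚ ℚ.< x → 0ℚ ℚ.< y → 0ℚ ℚ.< x ℚ.* y
pos*pos {x} {y} 0<x 0<y =
  ℚP.positive⁻¹ (x ℚ.* y) {{ℚP.pos*pos⇒pos x {{ℚ.positive 0<x}} y {{ℚ.positive 0<y}}}}

*-cancelʳ-pos : ∀ {x y d} → 0ℚ ℚ.< d → x ℚ.* d ≡ y ℚ.* d → x ≡ y
*-cancelʳ-pos {d = d} 0<d eq = ℚP.≤-antisym
  (ℚP.*-cancelʳ-≤-pos d {{ℚ.positive 0<d}} (ℚP.≤-reflexive eq))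
  (ℚP.*-cancelʳ-≤-pos d {{ℚ.positive 0<d}} (ℚP.≤-reflexive (sym eq)))

+-cancelʳ-< : ∀ {x y} s → x ℚ.+ s ℚ.< y ℚ.+ s → x ℚ.< y
+-cancelʳ-< {x} {y} s lt = subst₂ ℚ._<_ (cancel x) (cancel y) (ℚP.+-monoˡ-< (ℚ.- s) lt)
  where
  cancel : ∀ t → t ℚ.+ s ℚ.- s ≡ t
  cancel t = solve 2 (λ t s → t :+ s :- s := t) refl t s

+-cancelʳ-≡ : ∀ {x y} s → x ℚ.+ s ≡ y ℚ.+ s → x ≡ y
+-cancelʳ-≡ {x} {y} s eq = trans (cancel x) (trans (cong (ℚ._- s) eq) (sym (cancel y)))
  where
  cancel : ∀ t → t ≡ t ℚ.+ s ℚ.- s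
  cancel t = solve 2 (λ t s → t := t :+ s :- s) refl t s

<-of-shifted-difference : ∀ {x y s} → (x ℚ.- y) ℚ.- s ℚ.< ℚ.- s → x ℚ.< y
<-of-shifted-difference {x} {y} {s} lt = subst₂ ℚ._<_
  (solve 3 (λ x y s → ((x :- y) :- s) :+ (s :+ y) := x) refl x y s)
  (solve 2 (λ y s → (:- s) :+ (s :+ y) := y) refl y s)
  (ℚP.+-monoˡ-< (s ℚ.+ y) lt)

>-of-shifted-difference : ∀ {x y s} → ℚ.- s ℚ.< (x ℚ.- y) ℚ.- s → y ℚ.< x
>-of-shifted-difference {x} {y} {s} lt = subst₂ ℚ._<_
  (solve 2 (λ y s → (:- s) :+ (s :+ y) := y) refl y s)
  (solve 3 (λ x y s → ((x :- y) :- s) :+ (s :+ y) := x) refl x y s)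
  (ℚP.+-monoˡ-< (s ℚ.+ y) lt)

≡-of-shifted-difference : ∀ {x y s} → (x ℚ.- y) ℚ.- s ≡ ℚ.- s → x ≡ y
≡-of-shifted-difference {x} {y} {s} eq = begin
  x                                   ≡⟨ solve 3 (λ x y s → x := ((x :- y) :- s) :+ (s :+ y)) refl x y s ⟩
  ((x ℚ.- y) ℚ.- s) ℚ.+ (s ℚ.+ y)     ≡⟨ cong (ℚ._+ (s ℚ.+ y)) eq ⟩
  ℚ.- s ℚ.+ (s ℚ.+ y)                 ≡⟨ solve 2 (λ y s → (:- s) :+ (s :+ y) := y) refl y s ⟩
  y                                   ∎
  where open ≡-Reasoning

idempotent⇒0 : ∀ {r} → r ≡ r ℚ.+ r → r ≡ 0ℚ
idempotent⇒0 {r} e = begin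
  r                  ≡⟨ solve 1 (λ x → x := (x :+ x) :- x) refl r ⟩
  (r ℚ.+ r) ℚ.- r    ≡⟨ cong (ℚ._- r) (sym e) ⟩
  r ℚ.- r            ≡⟨ ℚP.+-inverseʳ r ⟩
  0ℚ                 ∎
  where open ≡-Reasoning

double≡0⇒0 : ∀ {r} → r ℚ.+ r ≡ 0ℚ → r ≡ 0ℚ
double≡0⇒0 {r} e = begin
  r                          ≡⟨ solve 1 (λ x → x := (x :+ x) :* con ℚ.½) refl r ⟩
  (r ℚ.+ r) ℚ.* ℚ.½          ≡⟨ cong (ℚ._* ℚ.½) e ⟩
  0ℚ ℚ.* ℚ.½                 ≡⟨ ℚP.*-zeroˡ ℚ.½ ⟩
  0ℚ                         ∎
  where open ≡-Reasoning

fin-injective : ∀ {x y} → fin x ≡ fin y → x ≡ y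
fin-injective refl = refl

≤∞-reflexive : ∀ {x y} → x ≡ y → x ≤∞ y
≤∞-reflexive {fin x} refl = fin≤fin ℚP.≤-refl
≤∞-reflexive {∞} refl = ∞ ≤∞∞

≤∞-trans : ∀ {x y z} → x ≤∞ y → y ≤∞ z → x ≤∞ z
≤∞-trans (fin≤fin a) (fin≤fin b) = fin≤fin (ℚP.≤-trans a b)
≤∞-trans (fin≤fin a) (_ ≤∞∞) = _ ≤∞∞
≤∞-trans (_ ≤∞∞) (.∞ ≤∞∞) = _ ≤∞∞

≤∞-antisym : ∀ {x y} → x ≤∞ y → y ≤∞ x → x ≡ y
≤∞-antisym (fin≤fin a) (fin≤fin b) = cong fin (ℚP.≤-antisym a b)
≤∞-antisym (.∞ ≤∞∞) (.∞ ≤∞∞) = refl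

<∞⇒≤∞ : ∀ {x y} → x <∞ y → x ≤∞ y
<∞⇒≤∞ (fin<fin a) = fin≤fin (ℚP.<⇒≤ a)
<∞⇒≤∞ fin<∞ = _ ≤∞∞

<∞-≤∞-absurd : ∀ {x y} → x <∞ y → y ≤∞ x → ⊥
<∞-≤∞-absurd (fin<fin a) (fin≤fin b) = ℚP.<-irrefl refl (ℚP.<-≤-trans a b)

∞≤∞⇒≡∞ : ∀ {z} → ∞ ≤∞ z → z ≡ ∞
∞≤∞⇒≡∞ (.∞ ≤∞∞) = refl

≤∞-≢⇒<∞ : ∀ {a y} → fin a ≤∞ y → ¬ (y ≡ fin a) → fin a <∞ y
≤∞-≢⇒<∞ {a} {fin y} (fin≤fin a≤y) y≢a with ℚP.<-cmp a y
... | tri< a<y _ _ = fin<fin a<y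
... | tri≈ _ a≡y _ = ⊥-elim (y≢a (cong fin (sym a≡y)))
... | tri> _ _ y<a = ⊥-elim (ℚP.<-irrefl refl (ℚP.<-≤-trans y<a a≤y))
≤∞-≢⇒<∞ {a} {∞} _ _ = fin<∞

_≟fin_ : ∀ x a → Dec (x ≡ fin a)
∞ ≟fin a = no (λ ())
fin x ≟fin a with x ℚP.≟ a
... | yes refl = yes refl
... | no x≢a = no (λ e → x≢a (fin-injective e))

min∞≤∞-one : ∀ {x y z} → min∞ x y ≤∞ z → x ≤∞ z ⊎ y ≤∞ z
min∞≤∞-one {fin x} {fin y} m≤z with ℚP.⊓-sel x y
... | inj₁ e = inj₁ (subst (λ t → fin t ≤∞ _) e m≤z)
... | inj₂ e = inj₂ (subst (λ t → fin t ≤∞ _) e m≤z)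
min∞≤∞-one {fin x} {∞} m≤z = inj₁ m≤z
min∞≤∞-one {∞} m≤z = inj₂ m≤z

+∞-absorbʳ : ∀ x → x +∞ ∞ ≡ ∞
+∞-absorbʳ (fin x) = refl
+∞-absorbʳ ∞ = refl

+fin-mono-≤ : ∀ {x y} s → x ≤∞ y → x +∞ fin s ≤∞ y +∞ fin s
+fin-mono-≤ s (fin≤fin a) = fin≤fin (ℚP.+-monoˡ-≤ s a)
+fin-mono-≤ s (_ ≤∞∞) = _ ≤∞∞

+fin-mono-< : ∀ {a y} s → fin a <∞ y → fin (a ℚ.+ s) <∞ y +∞ fin s
+fin-mono-< s (fin<fin lt) = fin<fin (ℚP.+-monoˡ-< s lt)
+fin-mono-< s fin<∞ = fin<∞

+fin-cancel-< : ∀ {x y} s → x +∞ fin s <∞ y +∞ fin s → x <∞ y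
+fin-cancel-< {fin x} {fin y} s (fin<fin lt) = fin<fin (+-cancelʳ-< s lt)
+fin-cancel-< {fin x} {∞} s _ = fin<∞

scale-shift : ∀ z y p s → (z +∞ p ·∞ y) +∞ fin (p ℚ.* s) ≡ z +∞ p ·∞ (y +∞ fin s)
scale-shift (fin z) (fin y) p s = cong fin (solve 4 (λ z y p s → (z :+ p :* y) :+ p :* s := z :+ p :* (y :+ s)) refl z y p s)
scale-shift (fin z) ∞ p s = refl
scale-shift ∞ y p s = refl

+∞-identityˡ : ∀ y → fin 0ℚ +∞ y ≡ y
+∞-identityˡ (fin y) = cong fin (ℚP.+-identityˡ y)
+∞-identityˡ ∞ = refl

+∞-identityʳ : ∀ y → y +∞ fin 0ℚ ≡ y
+∞-identityʳ (fin y) = cong fin (ℚP.+-identityʳ y)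
+∞-identityʳ ∞ = refl

+fin-cancel : ∀ y s → (y +∞ fin (ℚ.- s)) +∞ fin s ≡ y
+fin-cancel (fin y) s = cong fin (solve 2 (λ y s → (y :+ (:- s)) :+ s := y) refl y s)
+fin-cancel ∞ s = refl

·∞-identityˡ : ∀ y → 1ℚ ·∞ y ≡ y
·∞-identityˡ (fin y) = cong fin (ℚP.*-identityˡ y)
·∞-identityˡ ∞ = refl

·∞-suc : ∀ n y → y +∞ ℕ→ℚ n ·∞ y ≡ ℕ→ℚ (suc n) ·∞ y
·∞-suc n (fin y) = cong fin (trans (solve 2 (λ y n → y :+ n :* y := (con 1ℚ :+ n) :* y) refl y (ℕ→ℚ n))
                                   (cong (ℚ._* y) (sym (ℕ→ℚ-suc n))))
·∞-suc n ∞ = refl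

-- Ultrametric sums: z is at least one of x, y and equals the strictly
-- smaller one.  This is all a valuation tells us about v(X + Y).

record UltraSum (z x y : ℚ∞) : Set where
  field
    above-one  : x ≤∞ z ⊎ y ≤∞ z
    left-wins  : x <∞ y → z ≡ x
    right-wins : y <∞ x → z ≡ y
open UltraSum

UltraSum-lower : ∀ {t z x y} → UltraSum z x y → t ≤∞ x → t ≤∞ y → t ≤∞ z
UltraSum-lower S t≤x t≤y with above-one S
... | inj₁ x≤z = ≤∞-trans t≤x x≤z
... | inj₂ y≤z = ≤∞-trans t≤y y≤z

UltraSum-cong : ∀ {z x y z′ x′ y′} → z ≡ z′ → x ≡ x′ → y ≡ y′ → UltraSum z x y → UltraSum z′ x′ y′
UltraSum-cong refl refl refl S = S

left-wins-fin : ∀ {z x y a b} → UltraSum z x y → x ≡ fin a → y ≡ fin b → a ℚ.< b → z ≡ fin a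
left-wins-fin S refl refl a<b = left-wins S (fin<fin a<b)

right-wins-fin : ∀ {z x y a b} → UltraSum z x y → x ≡ fin a → y ≡ fin b → b ℚ.< a → z ≡ fin b
right-wins-fin S refl refl b<a = right-wins S (fin<fin b<a)

UltraSum-shift : ∀ {z x y} s → UltraSum z x y → UltraSum (z +∞ fin s) (x +∞ fin s) (y +∞ fin s)
UltraSum-shift s S = record
  { above-one  = ⊎-map (+fin-mono-≤ s) (+fin-mono-≤ s) (above-one S)
  ; left-wins  = λ lt → cong (_+∞ fin s) (left-wins S (+fin-cancel-< s lt))
  ; right-wins = λ lt → cong (_+∞ fin s) (right-wins S (+fin-cancel-< s lt))
  }

module Valuation {c ℓ} (K : ValuedField c ℓ) where
  open import Relation.Binary.Bundles using (Setoid)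
  open import Algebra.Bundles using (CommutativeRing)
  open ValuedField K hiding (refl; sym; trans)
  open import Relation.Binary.Reasoning.Setoid setoid
  open import Algebra.Properties.Ring (CommutativeRing.ring cring) using (-1*x≈-x; -‿distribʳ-*)
  open import Algebra.Properties.Group +-group using (⁻¹-involutive)
  private module ≈ = Setoid setoid

  -- v(1) = r satisfies r = r + r, so v(1) = 0
  v-1# : v 1# ≡ fin 0ℚ
  v-1# with v 1# in e
  ... | ∞ = ⊥-elim (0≉1 (≈.sym (v-∞ 1# e)))
  ... | fin r = cong fin (idempotent⇒0 (fin-injective doubled))
    where
    doubled : fin r ≡ fin (r ℚ.+ r)
    doubled = trans (sym e) (trans (v-cong (≈.sym (*-identityˡ 1#))) (trans (v-* 1# 1#) (cong₂ _+∞_ e e)))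

  -- (−1)² = 1, so v(−1) is a rational r with r + r = 0
  v-[-1#]² : v (- 1# * - 1#) ≡ fin 0ℚ
  v-[-1#]² = trans (v-cong (≈.trans (-1*x≈-x (- 1#)) (⁻¹-involutive 1#))) v-1#

  v-[-1#] : v (- 1#) ≡ fin 0ℚ
  v-[-1#] with v (- 1#) in e
  ... | ∞ with trans (sym v-[-1#]²) (trans (v-* (- 1#) (- 1#)) (cong (_+∞ v (- 1#)) e))
  ...   | ()
  v-[-1#] | fin r = cong fin (double≡0⇒0 (fin-injective (trans (sym (cong₂ _+∞_ e e))
                      (trans (sym (v-* (- 1#) (- 1#))) v-[-1#]²))))

  -- v(−x) = v(−1) + v(x) = v(x)
  v-neg : ∀ x → v (- x) ≡ v x
  v-neg x = trans (v-cong (≈.sym (-1*x≈-x x)))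
              (trans (v-* (- 1#) x) (trans (cong (_+∞ v x) v-[-1#]) (+∞-identityˡ (v x))))

  v-+-one : ∀ x y → v x ≤∞ v (x + y) ⊎ v y ≤∞ v (x + y)
  v-+-one x y = min∞≤∞-one (v-+ x y)

  dominant : ∀ x y → v x <∞ v y → v (x + y) ≡ v x
  dominant x y vx<vy = ≤∞-antisym upper lower
    where
    lower : v x ≤∞ v (x + y)
    lower with v-+-one x y
    ... | inj₁ vx≤ = vx≤
    ... | inj₂ vy≤ = ≤∞-trans (<∞⇒≤∞ vx<vy) vy≤
    x≈ : (x + y) + - y ≈ x
    x≈ = begin
      (x + y) + - y   ≈⟨ +-assoc x y (- y) ⟩
      x + (y + - y)   ≈⟨ +-cong ≈.refl (-‿inverseʳ y) ⟩
      x + 0#          ≈⟨ +-identityʳ x ⟩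
      x               ∎
    upper : v (x + y) ≤∞ v x
    upper with v-+-one (x + y) (- y)
    ... | inj₁ le = subst (v (x + y) ≤∞_) (v-cong x≈) le
    ... | inj₂ le = ⊥-elim (<∞-≤∞-absurd vx<vy (subst₂ _≤∞_ (v-neg y) (v-cong x≈) le))

  v-UltraSum : ∀ x y → UltraSum (v (x + y)) (v x) (v y)
  v-UltraSum x y = record
    { above-one  = v-+-one x y
    ; left-wins  = dominant x y
    ; right-wins = λ lt → trans (v-cong (+-comm x y)) (dominant y x lt)
    }

  -- v(xᵐ) = m·v(x) for m ≥ 1 (for m = 0 this fails when x = 0)
  v-pow-suc : ∀ x m → v (x ^ suc m) ≡ ℕ→ℚ (suc m) ·∞ v x
  v-pow-suc x zero = trans (v-* x 1#) (trans (cong (v x +∞_) v-1#) (trans (+∞-identityʳ (v x)) (sym (·∞-identityˡ (v x)))))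
  v-pow-suc x (suc m) = trans (v-* x (x ^ suc m)) (trans (cong (v x +∞_) (v-pow-suc x m)) (·∞-suc (suc m) (v x)))

  v-pow : ∀ x {m} → 1 ≤ m → v (x ^ m) ≡ ℕ→ℚ m ·∞ v x
  v-pow x {suc m} _ = v-pow-suc x m

  v-finite : ∀ x → ¬ (x ≈ 0#) → Σ ℚ λ a → v x ≡ fin a
  v-finite x x≉0 with v x in e
  ... | fin a = a , refl
  ... | ∞ = ⊥-elim (x≉0 (v-∞ x e))

  -- Solving T·b = b·P + R for b, where v(T) = −1 and v(P) = −s < −1:
  -- b·(T − P) = R and v(T − P) = −s, hence v(b) = v(R) + s.
  solve-for-coefficient : ∀ {T b P R s} → v T ≡ fin (ℚ.- 1ℚ) → v P ≡ fin (ℚ.- s) → 1ℚ ℚ.< s →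
                          T * b ≈ b * P + R → v b ≡ v R +∞ fin s
  solve-for-coefficient {T} {b} {P} {R} {s} vT vP 1<s eq =
    trans (sym (+fin-cancel (v b) s)) (cong (_+∞ fin s) (sym vR))
    where
    v[-P] : v (- P) ≡ fin (ℚ.- s)
    v[-P] = trans (v-neg P) vP
    v[T-P] : v (T + - P) ≡ fin (ℚ.- s)
    v[T-P] = trans (v-cong (+-comm T (- P)))
               (trans (dominant (- P) T (subst₂ _<∞_ (sym v[-P]) (sym vT) (fin<fin (ℚP.neg-antimono-< 1<s)))) v[-P])
    b[T-P]≈R : b * (T + - P) ≈ R
    b[T-P]≈R = begin
      b * (T + - P)               ≈⟨ distribˡ b T (- P) ⟩
      b * T + b * - P             ≈⟨ +-cong (*-comm b T) (≈.sym (-‿distribʳ-* b P)) ⟩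
      T * b + - (b * P)           ≈⟨ +-cong eq ≈.refl ⟩
      (b * P + R) + - (b * P)     ≈⟨ +-cong (+-comm (b * P) R) ≈.refl ⟩
      (R + b * P) + - (b * P)     ≈⟨ +-assoc R (b * P) (- (b * P)) ⟩
      R + (b * P + - (b * P))     ≈⟨ +-cong ≈.refl (-‿inverseʳ (b * P)) ⟩
      R + 0#                      ≈⟨ +-identityʳ R ⟩
      R                           ∎
    vR : v R ≡ v b +∞ fin (ℚ.- s)
    vR = trans (sym (v-cong b[T-P]≈R)) (trans (v-* b (T + - P)) (cong (v b +∞_) v[T-P]))

module Exponents (q : ℕ) (q≥2 : 2 ≤ q) where

  q^n≥1 : ∀ n → 1 ≤ q ℕ.^ n
  q^n≥1 zero = ℕ.s≤s ℕ.z≤n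
  q^n≥1 (suc n) = ℕP.*-mono-≤ (ℕP.<⇒≤ q≥2) (q^n≥1 n)

  Qq : ℚ
  Qq = ℕ→ℚ q

  P : ℕ → ℚ
  P n = ℕ→ℚ (q ℕ.^ n)

  P-suc : ∀ n → P (suc n) ≡ Qq ℚ.* P n
  P-suc n = ℕ→ℚ-* q (q ℕ.^ n)

  P-1 : P 1 ≡ Qq
  P-1 = trans (P-suc 0) (ℚP.*-identityʳ Qq)

  P-2 : P 2 ≡ Qq ℚ.* Qq
  P-2 = trans (P-suc 1) (cong (Qq ℚ.*_) P-1)

  P-pos : ∀ n → 0ℚ ℚ.< P n
  P-pos n = ℕ→ℚ-mono-< (q^n≥1 n)

  P>1 : ∀ n → 1ℚ ℚ.< P (suc n)
  P>1 n = ℕ→ℚ-mono-< (ℕP.^-monoʳ-< q q≥2 {0} {suc n} ℕ.z<s)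

  Qq>1 : 1ℚ ℚ.< Qq
  Qq>1 = subst (1ℚ ℚ.<_) P-1 (P>1 0)

  Qq+1>0 : 0ℚ ℚ.< Qq ℚ.+ 1ℚ
  Qq+1>0 = ℚP.<-trans (ℕ→ℚ-pos 0) (<-by-gap Qq (ℚP.<-trans (ℕ→ℚ-pos 0) Qq>1) (ℚP.+-comm Qq 1ℚ))

  F₁ F₂ : ℕ → ℚ
  F₁ n = frac (q ℕ.^ n ∸ 1) (q ∸ 1)
  F₂ n = frac (q ℕ.^ n ∸ 1) (q ℕ.^ 2 ∸ 1)

  ρ : ℚ
  ρ = frac 1 (q ℕ.+ 1)

  F₁-spec : ∀ n → F₁ n ℚ.* (Qq ℚ.- 1ℚ) ≡ P n ℚ.- 1ℚ
  F₁-spec n = begin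
    F₁ n ℚ.* (Qq ℚ.- 1ℚ)      ≡⟨ cong (F₁ n ℚ.*_) (sym (ℕ→ℚ-pred (ℕP.<⇒≤ q≥2))) ⟩
    F₁ n ℚ.* ℕ→ℚ (q ∸ 1)      ≡⟨ frac-spec _ (ℕP.∸-monoˡ-≤ 1 q≥2) ⟩
    ℕ→ℚ (q ℕ.^ n ∸ 1)        ≡⟨ ℕ→ℚ-pred (q^n≥1 n) ⟩
    P n ℚ.- 1ℚ                ∎
    where open ≡-Reasoning

  F₂-spec : ∀ n → F₂ n ℚ.* (Qq ℚ.* Qq ℚ.- 1ℚ) ≡ P n ℚ.- 1ℚ
  F₂-spec n = begin
    F₂ n ℚ.* (Qq ℚ.* Qq ℚ.- 1ℚ)   ≡⟨ cong (λ z → F₂ n ℚ.* (z ℚ.- 1ℚ)) (sym P-2) ⟩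
    F₂ n ℚ.* (P 2 ℚ.- 1ℚ)         ≡⟨ cong (F₂ n ℚ.*_) (sym (ℕ→ℚ-pred (q^n≥1 2))) ⟩
    F₂ n ℚ.* ℕ→ℚ (q ℕ.^ 2 ∸ 1)    ≡⟨ frac-spec _ (ℕP.∸-monoˡ-≤ 1 (ℕP.*-mono-≤ q≥2 (q^n≥1 1))) ⟩
    ℕ→ℚ (q ℕ.^ n ∸ 1)            ≡⟨ ℕ→ℚ-pred (q^n≥1 n) ⟩
    P n ℚ.- 1ℚ                    ∎
    where open ≡-Reasoning

  ρ-spec : ρ ℚ.* (Qq ℚ.+ 1ℚ) ≡ 1ℚ
  ρ-spec = trans (cong (ρ ℚ.*_) (sym (ℕ→ℚ-+ q 1))) (frac-spec 1 (ℕP.m≤n+m 1 q))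

  Qq-1>0 : 0ℚ ℚ.< Qq ℚ.- 1ℚ
  Qq-1>0 = 0<-difference Qq>1

  Qq²-1>0 : 0ℚ ℚ.< Qq ℚ.* Qq ℚ.- 1ℚ
  Qq²-1>0 = subst (0ℚ ℚ.<_) (solve 1 (λ x → (x :- con 1ℚ) :* (x :+ con 1ℚ) := x :* x :- con 1ℚ) refl Qq)
              (pos*pos Qq-1>0 Qq+1>0)

  ρ>0 : 0ℚ ℚ.< ρ
  ρ>0 = ℚP.*-cancelʳ-<-nonNeg (Qq ℚ.+ 1ℚ) {{ℚ.nonNegative (ℚP.<⇒≤ Qq+1>0)}}
          (subst₂ ℚ._<_ (sym (ℚP.*-zeroˡ (Qq ℚ.+ 1ℚ))) (sym ρ-spec) (ℕ→ℚ-pos 0))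

  F₁-0 : F₁ 0 ≡ 0ℚ
  F₁-0 = *-cancelʳ-pos Qq-1>0 (trans (F₁-spec 0) (trans (ℚP.+-inverseʳ 1ℚ) (sym (ℚP.*-zeroˡ (Qq ℚ.- 1ℚ)))))

  F₁-suc : ∀ n → F₁ (suc n) ≡ F₁ n ℚ.+ P n
  F₁-suc n = *-cancelʳ-pos Qq-1>0 (begin
    F₁ (suc n) ℚ.* (Qq ℚ.- 1ℚ)                ≡⟨ F₁-spec (suc n) ⟩
    P (suc n) ℚ.- 1ℚ                          ≡⟨ cong (ℚ._- 1ℚ) (P-suc n) ⟩
    Qq ℚ.* P n ℚ.- 1ℚ                         ≡⟨ solve 2 (λ x p → x :* p :- con 1ℚ := (p :- con 1ℚ) :+ p :* (x :- con 1ℚ)) refl Qq (P n) ⟩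
    (P n ℚ.- 1ℚ) ℚ.+ P n ℚ.* (Qq ℚ.- 1ℚ)      ≡⟨ cong (ℚ._+ P n ℚ.* (Qq ℚ.- 1ℚ)) (sym (F₁-spec n)) ⟩
    F₁ n ℚ.* (Qq ℚ.- 1ℚ) ℚ.+ P n ℚ.* (Qq ℚ.- 1ℚ) ≡⟨ sym (ℚP.*-distribʳ-+ (Qq ℚ.- 1ℚ) (F₁ n) (P n)) ⟩
    (F₁ n ℚ.+ P n) ℚ.* (Qq ℚ.- 1ℚ)            ∎)
    where open ≡-Reasoning

  F₁-1 : F₁ 1 ≡ 1ℚ
  F₁-1 = trans (F₁-suc 0) (trans (cong (ℚ._+ 1ℚ) F₁-0) (ℚP.+-identityˡ 1ℚ))

  F₁-two-steps : ∀ n → F₁ (suc (suc n)) ≡ F₁ n ℚ.+ P n ℚ.* (Qq ℚ.+ 1ℚ)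
  F₁-two-steps n = begin
    F₁ (suc (suc n))                     ≡⟨ F₁-suc (suc n) ⟩
    F₁ (suc n) ℚ.+ P (suc n)             ≡⟨ cong₂ ℚ._+_ (F₁-suc n) (P-suc n) ⟩
    F₁ n ℚ.+ P n ℚ.+ Qq ℚ.* P n          ≡⟨ solve 3 (λ f p x → f :+ p :+ x :* p := f :+ p :* (x :+ con 1ℚ)) refl (F₁ n) (P n) Qq ⟩
    F₁ n ℚ.+ P n ℚ.* (Qq ℚ.+ 1ℚ)         ∎
    where open ≡-Reasoning

  F₂-0 : F₂ 0 ≡ 0ℚ
  F₂-0 = *-cancelʳ-pos Qq²-1>0 (trans (F₂-spec 0) (trans (ℚP.+-inverseʳ 1ℚ) (sym (ℚP.*-zeroˡ (Qq ℚ.* Qq ℚ.- 1ℚ)))))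

  F₂-two-steps : ∀ n → F₂ (suc (suc n)) ≡ F₂ n ℚ.+ P n
  F₂-two-steps n = *-cancelʳ-pos Qq²-1>0 (begin
    F₂ (suc (suc n)) ℚ.* d                ≡⟨ F₂-spec (suc (suc n)) ⟩
    P (suc (suc n)) ℚ.- 1ℚ                ≡⟨ cong (ℚ._- 1ℚ) (trans (P-suc (suc n)) (cong (Qq ℚ.*_) (P-suc n))) ⟩
    Qq ℚ.* (Qq ℚ.* P n) ℚ.- 1ℚ            ≡⟨ solve 2 (λ x p → x :* (x :* p) :- con 1ℚ := (p :- con 1ℚ) :+ p :* (x :* x :- con 1ℚ)) refl Qq (P n) ⟩
    (P n ℚ.- 1ℚ) ℚ.+ P n ℚ.* d            ≡⟨ cong (ℚ._+ P n ℚ.* d) (sym (F₂-spec n)) ⟩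
    F₂ n ℚ.* d ℚ.+ P n ℚ.* d              ≡⟨ sym (ℚP.*-distribʳ-+ d (F₂ n) (P n)) ⟩
    (F₂ n ℚ.+ P n) ℚ.* d                  ∎)
    where
    open ≡-Reasoning
    d = Qq ℚ.* Qq ℚ.- 1ℚ

  F₂-suc : ∀ n → F₂ (suc n) ≡ F₂ n ℚ.+ ρ ℚ.* P n
  F₂-suc n = *-cancelʳ-pos Qq²-1>0 (begin
    F₂ (suc n) ℚ.* d                                ≡⟨ F₂-spec (suc n) ⟩
    P (suc n) ℚ.- 1ℚ                                ≡⟨ cong (ℚ._- 1ℚ) (P-suc n) ⟩
    Qq ℚ.* P n ℚ.- 1ℚ                               ≡⟨ solve 2 (λ x p → x :* p :- con 1ℚ := (p :- con 1ℚ) :+ con 1ℚ :* p :* (x :- con 1ℚ)) refl Qq (P n) ⟩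
    (P n ℚ.- 1ℚ) ℚ.+ 1ℚ ℚ.* P n ℚ.* (Qq ℚ.- 1ℚ)      ≡⟨ cong₂ (λ a b → a ℚ.+ b ℚ.* P n ℚ.* (Qq ℚ.- 1ℚ)) (sym (F₂-spec n)) (sym ρ-spec) ⟩
    F₂ n ℚ.* d ℚ.+ ρ ℚ.* (Qq ℚ.+ 1ℚ) ℚ.* P n ℚ.* (Qq ℚ.- 1ℚ)
       ≡⟨ solve 4 (λ f r p x → f :* (x :* x :- con 1ℚ) :+ r :* (x :+ con 1ℚ) :* p :* (x :- con 1ℚ)
                              := (f :+ r :* p) :* (x :* x :- con 1ℚ)) refl (F₂ n) ρ (P n) Qq ⟩
    (F₂ n ℚ.+ ρ ℚ.* P n) ℚ.* d                      ∎)
    where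
    open ≡-Reasoning
    d = Qq ℚ.* Qq ℚ.- 1ℚ

  F₂-1 : F₂ 1 ≡ ρ
  F₂-1 = trans (F₂-suc 0) (trans (cong (ℚ._+ ρ ℚ.* 1ℚ) F₂-0) (trans (ℚP.+-identityˡ _) (ℚP.*-identityʳ ρ)))

  F₁≡F₂[q+1] : ∀ n → F₁ n ≡ F₂ n ℚ.* (Qq ℚ.+ 1ℚ)
  F₁≡F₂[q+1] n = *-cancelʳ-pos Qq-1>0 (begin
    F₁ n ℚ.* (Qq ℚ.- 1ℚ)                       ≡⟨ F₁-spec n ⟩
    P n ℚ.- 1ℚ                                 ≡⟨ sym (F₂-spec n) ⟩
    F₂ n ℚ.* (Qq ℚ.* Qq ℚ.- 1ℚ)                ≡⟨ solve 2 (λ f x → f :* (x :* x :- con 1ℚ) := f :* (x :+ con 1ℚ) :* (x :- con 1ℚ)) refl (F₂ n) Qq ⟩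
    F₂ n ℚ.* (Qq ℚ.+ 1ℚ) ℚ.* (Qq ℚ.- 1ℚ)       ∎)
    where open ≡-Reasoning

record NewtonRecurrence (P : ℕ → ℚ) (u : ℚ∞) (w : ℚ) (α : ℕ → ℚ∞) : Set where
  field
    start₀ : α 0 ≡ fin 0ℚ
    start₁ : α 1 ≡ u
    step   : ∀ n → UltraSum (α (suc (suc n)))
                            (α (suc n) +∞ P (suc n) ·∞ u)
                            (α n +∞ fin (P n ℚ.* w))

pair-induction : {R : ℕ → Set} → R 0 → R 1 → (∀ n → R n → R (suc n) → R (suc (suc n))) → ∀ n → R n
pair-induction {R} r₀ r₁ next n = proj₁ (both n)
  where
  both : ∀ n → R n × R (suc n)
  both zero = r₀ , r₁
  both (suc n) = proj₂ (both n) , next n (proj₁ (both n)) (proj₂ (both n))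

parity-induction : {E O : ℕ → Set} → E 0 → O 1 →
                   (∀ n → E n → O (suc n) → E (suc (suc n))) →
                   (∀ n → O n → E (suc n) → O (suc (suc n))) →
                   ∀ m → E (2 ℕ.* m) × O (suc (2 ℕ.* m))
parity-induction e₀ o₁ even odd zero = e₀ , o₁
parity-induction {E} {O} e₀ o₁ even odd (suc m) =
  subst (λ k → E k × O (suc k)) (sym (ℕP.*-suc 2 m)) (e₂ , odd (suc (2 ℕ.* m)) (proj₂ ih) e₂)
  where
  ih : E (2 ℕ.* m) × O (suc (2 ℕ.* m))
  ih = parity-induction e₀ o₁ even odd m
  e₂ : E (suc (suc (2 ℕ.* m)))
  e₂ = even (2 ℕ.* m) (proj₁ ih) (proj₂ ih)

module NewtonSolutions (q : ℕ) (q≥2 : 2 ≤ q) where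
  open Exponents q q≥2

  F₁-left-step : ∀ n u → F₁ (suc n) ℚ.* u ℚ.+ P (suc n) ℚ.* u ≡ F₁ (suc (suc n)) ℚ.* u
  F₁-left-step n u = trans (sym (ℚP.*-distribʳ-+ u (F₁ (suc n)) (P (suc n)))) (cong (ℚ._* u) (sym (F₁-suc (suc n))))

  F₁-right-step : ∀ n u → F₁ n ℚ.* u ℚ.+ P n ℚ.* ((Qq ℚ.+ 1ℚ) ℚ.* u) ≡ F₁ (suc (suc n)) ℚ.* u
  F₁-right-step n u = trans (solve 4 (λ f p x u → f :* u :+ p :* ((x :+ con 1ℚ) :* u) := (f :+ p :* (x :+ con 1ℚ)) :* u) refl (F₁ n) (P n) Qq u)
                            (cong (ℚ._* u) (sym (F₁-two-steps n)))

  left-dominant : ∀ {u w α} → NewtonRecurrence P (fin u) w α → (Qq ℚ.+ 1ℚ) ℚ.* u ℚ.< w →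
                  ∀ n → α n ≡ fin (F₁ n ℚ.* u)
  left-dominant {u} {w} {α} R [q+1]u<w = pair-induction at₀ at₁ next
    where
    open NewtonRecurrence R
    at₀ : α 0 ≡ fin (F₁ 0 ℚ.* u)
    at₀ = trans start₀ (cong fin (sym (trans (cong (ℚ._* u) F₁-0) (ℚP.*-zeroˡ u))))
    at₁ : α 1 ≡ fin (F₁ 1 ℚ.* u)
    at₁ = trans start₁ (cong fin (sym (trans (cong (ℚ._* u) F₁-1) (ℚP.*-identityˡ u))))
    next : ∀ n → α n ≡ fin (F₁ n ℚ.* u) → α (suc n) ≡ fin (F₁ (suc n) ℚ.* u) →
           α (suc (suc n)) ≡ fin (F₁ (suc (suc n)) ℚ.* u)
    next n h₀ h₁ = trans (left-wins-fin (step n) (cong (_+∞ _) h₁) (cong (_+∞ _) h₀) left<right)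
                         (cong fin (F₁-left-step n u))
      where
      excess : ℚ
      excess = P n ℚ.* (w ℚ.- (Qq ℚ.+ 1ℚ) ℚ.* u)
      right≡left+excess : F₁ n ℚ.* u ℚ.+ P n ℚ.* w ≡ (F₁ (suc n) ℚ.* u ℚ.+ P (suc n) ℚ.* u) ℚ.+ excess
      right≡left+excess = begin
        F₁ n ℚ.* u ℚ.+ P n ℚ.* w
          ≡⟨ solve 5 (λ f p x u w → f :* u :+ p :* w := (f :* u :+ p :* ((x :+ con 1ℚ) :* u)) :+ p :* (w :- (x :+ con 1ℚ) :* u))
                     refl (F₁ n) (P n) Qq u w ⟩
        (F₁ n ℚ.* u ℚ.+ P n ℚ.* ((Qq ℚ.+ 1ℚ) ℚ.* u)) ℚ.+ excess
          ≡⟨ cong (ℚ._+ excess) (trans (F₁-right-step n u) (sym (F₁-left-step n u))) ⟩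
        (F₁ (suc n) ℚ.* u ℚ.+ P (suc n) ℚ.* u) ℚ.+ excess ∎
        where open ≡-Reasoning
      left<right : F₁ (suc n) ℚ.* u ℚ.+ P (suc n) ℚ.* u ℚ.< F₁ n ℚ.* u ℚ.+ P n ℚ.* w
      left<right = <-by-gap excess (pos*pos (P-pos n) (0<-difference [q+1]u<w)) right≡left+excess

  -- to prove an identity involving ρ, it may be checked modulo ρ(q+1) = 1
  modulo-ρ : ∀ {L R} K → L ≡ R ℚ.+ (ρ ℚ.* (Qq ℚ.+ 1ℚ) ℚ.* K ℚ.- K) → L ≡ R
  modulo-ρ {L} {R} K e = trans e (trans (cong (λ z → R ℚ.+ (z ℚ.* K ℚ.- K)) ρ-spec)
                                        (solve 2 (λ r k → r :+ (con 1ℚ :* k :- k) := r) refl R K))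

  right-dominant : ∀ {u w α} → NewtonRecurrence P (fin u) w α → w ℚ.< (Qq ℚ.+ 1ℚ) ℚ.* u →
                   ∀ m → α (2 ℕ.* m) ≡ fin (F₂ (2 ℕ.* m) ℚ.* w)
                       × α (suc (2 ℕ.* m)) ≡ fin (F₂ (suc (2 ℕ.* m)) ℚ.* w ℚ.+ ρ ℚ.* ((Qq ℚ.+ 1ℚ) ℚ.* u ℚ.- w))
  right-dominant {u} {w} {α} R w<[q+1]u = parity-induction even₀ odd₁ even-step odd-step
    where
    open NewtonRecurrence R
    e : ℚ
    e = ρ ℚ.* ((Qq ℚ.+ 1ℚ) ℚ.* u ℚ.- w)
    e>0 : 0ℚ ℚ.< e
    e>0 = pos*pos ρ>0 (0<-difference w<[q+1]u)
    Even Odd : ℕ → Set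
    Even n = α n ≡ fin (F₂ n ℚ.* w)
    Odd n = α n ≡ fin (F₂ n ℚ.* w ℚ.+ e)
    right-value : ∀ n → F₂ n ℚ.* w ℚ.+ P n ℚ.* w ≡ F₂ (suc (suc n)) ℚ.* w
    right-value n = trans (sym (ℚP.*-distribʳ-+ w (F₂ n) (P n))) (cong (ℚ._* w) (sym (F₂-two-steps n)))
    even₀ : Even 0
    even₀ = trans start₀ (cong fin (sym (trans (cong (ℚ._* w) F₂-0) (ℚP.*-zeroˡ w))))
    odd₁ : Odd 1
    odd₁ = trans start₁ (cong fin (sym (trans (cong (λ f → f ℚ.* w ℚ.+ e) F₂-1)
             (modulo-ρ u (solve 4 (λ r x u w → r :* w :+ r :* ((x :+ con 1ℚ) :* u :- w) := u :+ (r :* (x :+ con 1ℚ) :* u :- u))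
                                  refl ρ Qq u w)))))
    even-step : ∀ n → Even n → Odd (suc n) → Even (suc (suc n))
    even-step n h₀ h₁ = trans (right-wins-fin (step n) (cong (_+∞ _) h₁) (cong (_+∞ _) h₀) right<left)
                              (cong fin (right-value n))
      where
      right<left : F₂ n ℚ.* w ℚ.+ P n ℚ.* w ℚ.< (F₂ (suc n) ℚ.* w ℚ.+ e) ℚ.+ P (suc n) ℚ.* u
      right<left = <-by-gap (e ℚ.* (1ℚ ℚ.+ P (suc n))) (pos*pos e>0 (ℚP.<-trans (ℕ→ℚ-pos 0) (<-by-gap _ (P-pos (suc n)) refl)))
        (begin
          (F₂ (suc n) ℚ.* w ℚ.+ e) ℚ.+ P (suc n) ℚ.* u
            ≡⟨ cong₂ (λ f p → (f ℚ.* w ℚ.+ e) ℚ.+ p ℚ.* u) (F₂-suc n) (P-suc n) ⟩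
          ((F₂ n ℚ.+ ρ ℚ.* P n) ℚ.* w ℚ.+ e) ℚ.+ Qq ℚ.* P n ℚ.* u
            ≡⟨ modulo-ρ (P n ℚ.* w ℚ.- Qq ℚ.* P n ℚ.* u)
                 (solve 6 (λ f r p x u w →
                    ((f :+ r :* p) :* w :+ r :* ((x :+ con 1ℚ) :* u :- w)) :+ x :* p :* u
                    := ((f :* w :+ p :* w) :+ r :* ((x :+ con 1ℚ) :* u :- w) :* (con 1ℚ :+ x :* p))
                       :+ (r :* (x :+ con 1ℚ) :* (p :* w :- x :* p :* u) :- (p :* w :- x :* p :* u)))
                    refl (F₂ n) ρ (P n) Qq u w) ⟩
          (F₂ n ℚ.* w ℚ.+ P n ℚ.* w) ℚ.+ e ℚ.* (1ℚ ℚ.+ Qq ℚ.* P n)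
            ≡⟨ cong (λ p → (F₂ n ℚ.* w ℚ.+ P n ℚ.* w) ℚ.+ e ℚ.* (1ℚ ℚ.+ p)) (sym (P-suc n)) ⟩
          (F₂ n ℚ.* w ℚ.+ P n ℚ.* w) ℚ.+ e ℚ.* (1ℚ ℚ.+ P (suc n)) ∎)
        where open ≡-Reasoning
    odd-step : ∀ n → Odd n → Even (suc n) → Odd (suc (suc n))
    odd-step n h₀ h₁ = trans (right-wins-fin (step n) (cong (_+∞ _) h₁) (cong (_+∞ _) h₀) right<left)
                             (cong fin right-value′)
      where
      right-value′ : (F₂ n ℚ.* w ℚ.+ e) ℚ.+ P n ℚ.* w ≡ F₂ (suc (suc n)) ℚ.* w ℚ.+ e
      right-value′ = trans (solve 4 (λ f e p w → (f :* w :+ e) :+ p :* w := (f :* w :+ p :* w) :+ e) refl (F₂ n) e (P n) w)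
                           (cong (ℚ._+ e) (right-value n))
      right<left : (F₂ n ℚ.* w ℚ.+ e) ℚ.+ P n ℚ.* w ℚ.< F₂ (suc n) ℚ.* w ℚ.+ P (suc n) ℚ.* u
      right<left = <-by-gap (e ℚ.* (P (suc n) ℚ.- 1ℚ)) (pos*pos e>0 (0<-difference (P>1 n)))
        (begin
          F₂ (suc n) ℚ.* w ℚ.+ P (suc n) ℚ.* u
            ≡⟨ cong₂ (λ f p → f ℚ.* w ℚ.+ p ℚ.* u) (F₂-suc n) (P-suc n) ⟩
          (F₂ n ℚ.+ ρ ℚ.* P n) ℚ.* w ℚ.+ Qq ℚ.* P n ℚ.* u
            ≡⟨ modulo-ρ (P n ℚ.* w ℚ.- Qq ℚ.* P n ℚ.* u)
                 (solve 6 (λ f r p x u w →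
                    (f :+ r :* p) :* w :+ x :* p :* u
                    := ((f :* w :+ r :* ((x :+ con 1ℚ) :* u :- w)) :+ p :* w :+ r :* ((x :+ con 1ℚ) :* u :- w) :* (x :* p :- con 1ℚ))
                       :+ (r :* (x :+ con 1ℚ) :* (p :* w :- x :* p :* u) :- (p :* w :- x :* p :* u)))
                    refl (F₂ n) ρ (P n) Qq u w) ⟩
          ((F₂ n ℚ.* w ℚ.+ e) ℚ.+ P n ℚ.* w) ℚ.+ e ℚ.* (Qq ℚ.* P n ℚ.- 1ℚ)
            ≡⟨ cong (λ p → ((F₂ n ℚ.* w ℚ.+ e) ℚ.+ P n ℚ.* w) ℚ.+ e ℚ.* (p ℚ.- 1ℚ)) (sym (P-suc n)) ⟩
          ((F₂ n ℚ.* w ℚ.+ e) ℚ.+ P n ℚ.* w) ℚ.+ e ℚ.* (P (suc n) ℚ.- 1ℚ) ∎)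
        where open ≡-Reasoning

  right-dominant-∞ : ∀ {w α} → NewtonRecurrence P ∞ w α →
                     ∀ m → α (2 ℕ.* m) ≡ fin (F₂ (2 ℕ.* m) ℚ.* w) × α (suc (2 ℕ.* m)) ≡ ∞
  right-dominant-∞ {w} {α} R = parity-induction even₀ start₁ even-step odd-step
    where
    open NewtonRecurrence R
    Even Odd : ℕ → Set
    Even n = α n ≡ fin (F₂ n ℚ.* w)
    Odd n = α n ≡ ∞
    even₀ : Even 0
    even₀ = trans start₀ (cong fin (sym (trans (cong (ℚ._* w) F₂-0) (ℚP.*-zeroˡ w))))
    left-∞ : ∀ n → α (suc n) +∞ P (suc n) ·∞ ∞ ≡ ∞
    left-∞ n = +∞-absorbʳ (α (suc n))
    even-step : ∀ n → Even n → Odd (suc n) → Even (suc (suc n))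
    even-step n h₀ _ = trans (right-wins (step n) (subst₂ _<∞_ (sym (cong (_+∞ _) h₀)) (sym (left-∞ n)) fin<∞))
                             (trans (cong (_+∞ _) h₀) (cong fin (trans (sym (ℚP.*-distribʳ-+ w (F₂ n) (P n)))
                                                                       (cong (ℚ._* w) (sym (F₂-two-steps n))))))
    odd-step : ∀ n → Odd n → Even (suc n) → Odd (suc (suc n))
    odd-step n h₀ _ = ∞≤∞⇒≡∞ (UltraSum-lower (step n) (≤∞-reflexive (sym (left-∞ n)))
                                                      (≤∞-reflexive (sym (cong (_+∞ _) h₀))))

  -- Case w = (q+1)u: both candidates are at least F₁(n+2)·u, so
  -- αₙ ≥ F₁ n · u, and at one of any two consecutive indices equality holds.
  module Balanced {u w α} (R : NewtonRecurrence P (fin u) w α) (w≡[q+1]u : w ≡ (Qq ℚ.+ 1ℚ) ℚ.* u) where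
    open NewtonRecurrence R

    Exact : ℕ → Set
    Exact n = α n ≡ fin (F₁ n ℚ.* u)

    exact₀ : Exact 0
    exact₀ = trans start₀ (cong fin (sym (trans (cong (ℚ._* u) F₁-0) (ℚP.*-zeroˡ u))))

    exact₁ : Exact 1
    exact₁ = trans start₁ (cong fin (sym (trans (cong (ℚ._* u) F₁-1) (ℚP.*-identityˡ u))))

    right-value : ∀ n → F₁ n ℚ.* u ℚ.+ P n ℚ.* w ≡ F₁ (suc (suc n)) ℚ.* u
    right-value n = trans (cong (λ z → F₁ n ℚ.* u ℚ.+ P n ℚ.* z) w≡[q+1]u) (F₁-right-step n u)

    lower-bound : ∀ n → fin (F₁ n ℚ.* u) ≤∞ α n
    lower-bound = pair-induction (≤∞-reflexive (sym exact₀)) (≤∞-reflexive (sym exact₁)) next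
      where
      next : ∀ n → fin (F₁ n ℚ.* u) ≤∞ α n → fin (F₁ (suc n) ℚ.* u) ≤∞ α (suc n) →
             fin (F₁ (suc (suc n)) ℚ.* u) ≤∞ α (suc (suc n))
      next n l₀ l₁ = UltraSum-lower (step n)
        (subst (_≤∞ α (suc n) +∞ fin (P (suc n) ℚ.* u)) (cong fin (F₁-left-step n u)) (+fin-mono-≤ (P (suc n) ℚ.* u) l₁))
        (subst (_≤∞ α n +∞ fin (P n ℚ.* w)) (cong fin (right-value n)) (+fin-mono-≤ (P n ℚ.* w) l₀))

    -- if αₙ is exact and αₙ₊₁ is not, the right candidate wins at n + 2
    exact-after-gap : ∀ n → Exact n → ¬ Exact (suc n) → Exact (suc (suc n))
    exact-after-gap n h₀ ¬h₁ = trans (right-wins (step n) right<left) (trans (cong (_+∞ _) h₀) (cong fin (right-value n)))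
      where
      right<left : α n +∞ fin (P n ℚ.* w) <∞ α (suc n) +∞ fin (P (suc n) ℚ.* u)
      right<left = subst (_<∞ _) (trans (cong fin (trans (F₁-left-step n u) (sym (right-value n))))
                                        (sym (cong (_+∞ _) h₀)))
                     (+fin-mono-< (P (suc n) ℚ.* u) (≤∞-≢⇒<∞ (lower-bound (suc n)) ¬h₁))

    exact-one-of-two : ∀ n → Exact n ⊎ Exact (suc n)
    exact-one-of-two zero = inj₁ exact₀
    exact-one-of-two (suc n) with α (suc n) ≟fin (F₁ (suc n) ℚ.* u)
    ... | yes h₁ = inj₁ h₁
    ... | no ¬h₁ with exact-one-of-two n
    ...   | inj₁ h₀ = inj₂ (exact-after-gap n h₀ ¬h₁)
    ...   | inj₂ h₁ = ⊥-elim (¬h₁ h₁)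

    exact-infinitely-often : ∀ N → Σ ℕ λ n → N ≤ n × Exact n
    exact-infinitely-often N with exact-one-of-two N
    ... | inj₁ h = N , ℕP.≤-refl , h
    ... | inj₂ h = suc N , ℕP.n≤1+n N , h

module LogCoefficients {c ℓ} (K : ValuedField c ℓ) (q : ℕ) (q≥2 : 2 ≤ q)
  {T A B : ValuedField.Carrier K} {β : ℕ → ValuedField.Carrier K}
  (vT : ValuedField.v K T ≡ fin (ℚ.- 1ℚ)) (L : IsLogCoeffs K q T A B β) where
  open ValuedField K hiding (refl; sym; trans)
  open Valuation K
  open Exponents q q≥2
  open IsLogCoeffs L
  open import Relation.Binary.Bundles using (Setoid)
  private module ≈ = Setoid setoid

  α : ℕ → ℚ∞
  α n = v (β n)

  v[T^qⁿ] : ∀ n → v (T ^ (q ℕ.^ n)) ≡ fin (ℚ.- P n)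
  v[T^qⁿ] n = trans (v-pow T (q^n≥1 n)) (trans (cong (P n ·∞_) vT)
                (cong fin (solve 1 (λ p → p :* (:- con 1ℚ) := :- p) refl (P n))))

  X Y : ℕ → Carrier
  X n = β (suc n) * A ^ (q ℕ.^ suc n)
  Y n = β n * B ^ (q ℕ.^ n)

  -- dividing the recurrence for βₙ₊₂ by T − T^{qⁿ⁺²}
  α-step : ∀ n → α (suc (suc n)) ≡ v (X n + Y n) +∞ fin (P (suc (suc n)))
  α-step n = solve-for-coefficient vT (v[T^qⁿ] (suc (suc n))) (P>1 (suc n)) (≈.trans (βₙ n) (+-assoc _ _ _))

  v[X] : ∀ n → v (X n) +∞ fin (P (suc (suc n))) ≡ α (suc n) +∞ P (suc n) ·∞ (v A +∞ fin Qq)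
  v[X] n = begin
    v (X n) +∞ fin (P (suc (suc n)))                         ≡⟨ cong₂ _+∞_ (trans (v-* _ _) (cong (α (suc n) +∞_) (v-pow A (q^n≥1 (suc n)))))
                                                                           (cong fin (trans (P-suc (suc n)) (ℚP.*-comm Qq (P (suc n))))) ⟩
    (α (suc n) +∞ P (suc n) ·∞ v A) +∞ fin (P (suc n) ℚ.* Qq) ≡⟨ scale-shift (α (suc n)) (v A) (P (suc n)) Qq ⟩
    α (suc n) +∞ P (suc n) ·∞ (v A +∞ fin Qq)                ∎
    where open ≡-Reasoning

  v[Y] : ∀ {b} → v B ≡ fin b → ∀ n → v (Y n) +∞ fin (P (suc (suc n))) ≡ α n +∞ fin (P n ℚ.* (b ℚ.+ P 2))
  v[Y] {b} vB n = begin
    v (Y n) +∞ fin (P (suc (suc n)))                  ≡⟨ cong₂ _+∞_ (trans (v-* _ _) (cong (α n +∞_) (trans (v-pow B (q^n≥1 n)) (cong (P n ·∞_) vB))))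
                                                                    (cong fin P[n+2]) ⟩
    (α n +∞ P n ·∞ fin b) +∞ fin (P n ℚ.* P 2)        ≡⟨ scale-shift (α n) (fin b) (P n) (P 2) ⟩
    α n +∞ fin (P n ℚ.* (b ℚ.+ P 2))                  ∎
    where
    open ≡-Reasoning
    P[n+2] : P (suc (suc n)) ≡ P n ℚ.* P 2
    P[n+2] = trans (P-suc (suc n)) (trans (cong (Qq ℚ.*_) (P-suc n))
               (trans (solve 2 (λ x p → x :* (x :* p) := p :* (x :* x)) refl Qq (P n)) (cong (P n ℚ.*_) (sym P-2))))

  newton : ∀ {b} → v B ≡ fin b → NewtonRecurrence P (v A +∞ fin Qq) (b ℚ.+ P 2) α
  newton vB = record
    { start₀ = trans (v-cong β₀) v-1#
    ; start₁ = trans (solve-for-coefficient vT (v[T^qⁿ] 1) (P>1 0) β₁)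
                     (cong₂ _+∞_ (v-cong (≈.trans (*-cong β₀ ≈.refl) (≈.trans (*-identityˡ _) (*-identityʳ A)))) (cong fin P-1))
    ; step   = λ n → UltraSum-cong (sym (α-step n)) (v[X] n) (v[Y] vB n)
                       (UltraSum-shift (P (suc (suc n))) (v-UltraSum (X n) (Y n)))
    }

module Cases {c ℓ} (K : ValuedField c ℓ) (q : ℕ) (q≥2 : 2 ≤ q)
  {T A B j : ValuedField.Carrier K} {β : ℕ → ValuedField.Carrier K}
  (vT : ValuedField.v K T ≡ fin (ℚ.- 1ℚ)) (B≉0 : ¬ ValuedField._≈_ K B (ValuedField.0# K))
  (jB≈A^[q+1] : ValuedField._≈_ K (ValuedField._*_ K j B) (ValuedField._^_ K A (q ℕ.+ 1)))
  (L : IsLogCoeffs K q T A B β) where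
  open ValuedField K hiding (refl; sym; trans)
  open Valuation K
  open Exponents q q≥2
  open NewtonSolutions q q≥2
  open LogCoefficients K q q≥2 vT L

  b : ℚ
  b = proj₁ (v-finite B B≉0)

  vB : v B ≡ fin b
  vB = proj₂ (v-finite B B≉0)

  w : ℚ
  w = b ℚ.+ P 2

  w-spec : v B +∞ fin (P 2) ≡ fin w
  w-spec = cong (_+∞ fin (P 2)) vB

  recurrence-fin : ∀ {a} → v A ≡ fin a → NewtonRecurrence P (fin (a ℚ.+ Qq)) w α
  recurrence-fin eA = subst (λ x → NewtonRecurrence P (x +∞ fin Qq) w α) eA (newton vB)

  recurrence-∞ : v A ≡ ∞ → NewtonRecurrence P ∞ w α
  recurrence-∞ eA = subst (λ x → NewtonRecurrence P (x +∞ fin Qq) w α) eA (newton vB)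

  v[jB] : v j +∞ fin b ≡ ℕ→ℚ (q ℕ.+ 1) ·∞ v A
  v[jB] = trans (cong (v j +∞_) (sym vB))
            (trans (sym (v-* j B)) (trans (v-cong jB≈A^[q+1]) (v-pow A (ℕP.m≤n+m 1 q))))

  -- the excess (q+1)u − w, i.e. v(j) + q
  gap : ℚ → ℚ
  gap a = (Qq ℚ.+ 1ℚ) ℚ.* (a ℚ.+ Qq) ℚ.- w

  v[j]-∞ : v A ≡ ∞ → v j ≡ ∞
  v[j]-∞ eA with v j in ej
  ... | ∞ = refl
  ... | fin _ with trans (sym (cong (_+∞ fin b) ej)) (trans v[jB] (cong (ℕ→ℚ (q ℕ.+ 1) ·∞_) eA))
  ...   | ()

  v[j]-fin : ∀ {a} → v A ≡ fin a → v j ≡ fin (gap a ℚ.- Qq)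
  v[j]-fin {a} eA with v j in ej
  ... | ∞ with trans (sym (cong (_+∞ fin b) ej)) (trans v[jB] (cong (ℕ→ℚ (q ℕ.+ 1) ·∞_) eA))
  ...   | ()
  v[j]-fin {a} eA | fin jv = cong fin (+-cancelʳ-≡ b (begin
    jv ℚ.+ b                          ≡⟨ fin-injective (trans (sym (cong (_+∞ fin b) ej)) (trans v[jB] (cong (ℕ→ℚ (q ℕ.+ 1) ·∞_) eA))) ⟩
    ℕ→ℚ (q ℕ.+ 1) ℚ.* a               ≡⟨ cong (ℚ._* a) (ℕ→ℚ-+ q 1) ⟩
    (Qq ℚ.+ 1ℚ) ℚ.* a                 ≡⟨ solve 3 (λ x a b → (x :+ con 1ℚ) :* a
                                                   := ((x :+ con 1ℚ) :* (a :+ x) :- (b :+ x :* x) :- x) :+ b) refl Qq a b ⟩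
    ((Qq ℚ.+ 1ℚ) ℚ.* (a ℚ.+ Qq) ℚ.- (b ℚ.+ Qq ℚ.* Qq) ℚ.- Qq) ℚ.+ b
                                      ≡⟨ cong (λ z → ((Qq ℚ.+ 1ℚ) ℚ.* (a ℚ.+ Qq) ℚ.- (b ℚ.+ z) ℚ.- Qq) ℚ.+ b) (sym P-2) ⟩
    (gap a ℚ.- Qq) ℚ.+ b              ∎))
    where open ≡-Reasoning

  v[j]+q : ∀ {a} → v A ≡ fin a → v j +∞ fin Qq ≡ fin (gap a)
  v[j]+q {a} eA = trans (cong (_+∞ fin Qq) (v[j]-fin eA)) (cong fin (solve 2 (λ g x → (g :- x) :+ x := g) refl (gap a) Qq))

  part₁ : v j <∞ fin (ℚ.- Qq) → ∀ n → α n ≡ F₁ n ·∞ (v A +∞ fin Qq)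
  part₁ vj<-q n with v A in eA
  ... | ∞ with subst (_<∞ fin (ℚ.- Qq)) (v[j]-∞ eA) vj<-q
  ...   | ()
  part₁ vj<-q n | fin a with subst (_<∞ fin (ℚ.- Qq)) (v[j]-fin eA) vj<-q
  ...   | fin<fin lt = left-dominant (recurrence-fin eA) (<-of-shifted-difference lt) n

  part₂ : fin (ℚ.- Qq) <∞ v j → ∀ m →
            α (2 ℕ.* m) ≡ F₂ (2 ℕ.* m) ·∞ (v B +∞ fin (P 2))
          × α (suc (2 ℕ.* m)) ≡ F₂ (suc (2 ℕ.* m)) ·∞ (v B +∞ fin (P 2)) +∞ ρ ·∞ (v j +∞ fin Qq)
  part₂ -q<vj m with v A in eA
  ... | ∞ = trans (proj₁ sol) (cong (F₂ (2 ℕ.* m) ·∞_) (sym w-spec))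
          , trans (proj₂ sol) (sym (trans (cong (λ x → F₂ (suc (2 ℕ.* m)) ·∞ (v B +∞ fin (P 2)) +∞ ρ ·∞ (x +∞ fin Qq)) (v[j]-∞ eA))
                                          (+∞-absorbʳ _)))
    where sol = right-dominant-∞ (recurrence-∞ eA) m
  ... | fin a with subst (fin (ℚ.- Qq) <∞_) (v[j]-fin eA) -q<vj
  ...   | fin<fin lt = trans (proj₁ sol) (cong (F₂ (2 ℕ.* m) ·∞_) (sym w-spec))
                     , trans (proj₂ sol) (sym (cong₂ (λ x y → F₂ (suc (2 ℕ.* m)) ·∞ x +∞ ρ ·∞ y) w-spec (v[j]+q eA)))
    where sol = right-dominant (recurrence-fin eA) (>-of-shifted-difference lt) m

  part₃ : v j ≡ fin (ℚ.- Qq) →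
            (∀ n → F₁ n ·∞ (v A +∞ fin Qq) ≡ F₂ n ·∞ (v B +∞ fin (P 2)))
          × (∀ n → F₁ n ·∞ (v A +∞ fin Qq) ≤∞ α n)
          × (∀ N → Σ ℕ λ n → N ≤ n × α n ≡ F₁ n ·∞ (v A +∞ fin Qq))
  part₃ vj≡-q with v A in eA
  ... | ∞ with trans (sym (v[j]-∞ eA)) vj≡-q
  ...   | ()
  part₃ vj≡-q | fin a = F₁≡F₂ , lower-bound , exact-infinitely-often
    where
    w≡[q+1]u : w ≡ (Qq ℚ.+ 1ℚ) ℚ.* (a ℚ.+ Qq)
    w≡[q+1]u = sym (≡-of-shifted-difference (fin-injective (trans (sym (v[j]-fin eA)) vj≡-q)))
    open Balanced (recurrence-fin eA) w≡[q+1]u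
    F₁≡F₂ : ∀ n → fin (F₁ n ℚ.* (a ℚ.+ Qq)) ≡ F₂ n ·∞ (v B +∞ fin (P 2))
    F₁≡F₂ n = trans (cong fin (begin
      F₁ n ℚ.* (a ℚ.+ Qq)                     ≡⟨ cong (ℚ._* (a ℚ.+ Qq)) (F₁≡F₂[q+1] n) ⟩
      F₂ n ℚ.* (Qq ℚ.+ 1ℚ) ℚ.* (a ℚ.+ Qq)     ≡⟨ ℚP.*-assoc (F₂ n) (Qq ℚ.+ 1ℚ) (a ℚ.+ Qq) ⟩
      F₂ n ℚ.* ((Qq ℚ.+ 1ℚ) ℚ.* (a ℚ.+ Qq))   ≡⟨ cong (F₂ n ℚ.*_) (sym w≡[q+1]u) ⟩
      F₂ n ℚ.* w                              ∎)) (cong (F₂ n ·∞_) (sym w-spec))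
      where open ≡-Reasoning

prime-power≥2 : ∀ {p} → Prime p → ∀ k → 2 ≤ p ℕ.^ suc k
prime-power≥2 {p} p-prime k = ℕP.*-mono-≤ (ℕ.nonTrivial⇒n>1 p {{prime⇒nonTrivial p-prime}})
                                          (ℕP.m^n>0 p {{prime⇒nonZero p-prime}} k)

-- Lemma 4.1.
lemma4p1 : ∀ {c ℓ} (K : ValuedField c ℓ) → let open ValuedField K in
  (p k : ℕ) → Prime p → (q : ℕ) → q ≡ p ℕ.^ ℕ.suc k → ι p ≈ 0# →
  (T : Carrier) → v T ≡ fin (ℚ.- ℚ.1ℚ) →
  (A B : Carrier) → ¬ (B ≈ 0#) →
  (j : Carrier) → j * B ≈ A ^ (q ℕ.+ 1) →
  (β : ℕ → Carrier) → IsLogCoeffs K q T A B β →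
  let Q = ℕ→ℚ
      f₁ = λ n → frac (q ℕ.^ n ∸ 1) (q ∸ 1) ·∞ (v A +∞ fin (Q q))
      f₂ = λ n → frac (q ℕ.^ n ∸ 1) (q ℕ.^ 2 ∸ 1) ·∞ (v B +∞ fin (Q (q ℕ.^ 2)))
      -q = fin (ℚ.- Q q)
  in
    (v j <∞ -q → ∀ n → v (β n) ≡ f₁ n)
  × (-q <∞ v j → ∀ m → v (β (2 ℕ.* m)) ≡ f₂ (2 ℕ.* m))
  × (-q <∞ v j → ∀ m → v (β (ℕ.suc (2 ℕ.* m))) ≡
                         f₂ (ℕ.suc (2 ℕ.* m)) +∞ frac 1 (q ℕ.+ 1) ·∞ (v j +∞ fin (Q q)))
  × (v j ≡ -q →
        (∀ n → f₁ n ≡ f₂ n)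
      × (∀ n → f₁ n ≤∞ v (β n))
      × (∀ N → Σ ℕ λ n → N ≤ n × v (β n) ≡ f₁ n))
lemma4p1 K p k p-prime q q≡p^[k+1] _ _ vT _ _ B≉0 _ jB≈A^[q+1] _ L =
  part₁ , (λ -q<vj m → proj₁ (part₂ -q<vj m)) , (λ -q<vj m → proj₂ (part₂ -q<vj m)) , part₃
  where
  q≥2 : 2 ≤ q
  q≥2 = subst (2 ≤_) (sym q≡p^[k+1]) (prime-power≥2 p-prime k)
  open Cases K q q≥2 vT B≉0 jB≈A^[q+1] L
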